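{- No 1-random set $A\subseteq\omega$ is uniformly introenumerable.
   Context: Sets are identified with elements of $2^{\omega}$. A set is 1-random (Martin-Löf random) if it is not in $\bigcap_m G_m$ for any uniformly $\Sigma^0_1$ sequence of open sets $(G_m)$ with $\mu(G_m)\le 2^{ -m}$. An enumeration operator is a c.e. set $W$, acting by $W(B)=\{x:(\exists y)[\langle x,y\rangle\in W\wedge D_y\subseteq B]\}$, where $(D_y)$ is the canonical listing of finite sets. An infinite set $X$ is uniformly introenumerable if there is an enumeration operator $\Gamma$ with $\Gamma(Y)=X$ for every infinite $Y\subseteq X$. -}

module Defs where

open import Data.Nat using (ℕ; zero; suc; _+_; _*_; _^_; _≤_; _%_; _≡ᵇ_; ⌊_/2⌋)
open import Data.Bool using (Bool; true; false; _∧_; _∨_)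
open import Data.List using (List; []; _∷_; length; filterᵇ; map; _++_)
open import Data.Bool.ListAction using (any)
open import Data.List.Relation.Unary.All using (All)
open import Data.Vec using (Vec; []; _∷_; lookup)
open import Data.Fin using (Fin)
open import Data.Product using (Σ; _×_; ∃)
open import Relation.Binary.PropositionalEquality using (_≡_)
open import Relation.Nullary using (¬_)

Set2ω : Set
Set2ω = ℕ → Bool

_∈ₛ_ : ℕ → Set2ω → Set
x ∈ₛ X = X x ≡ true

_⊆ₛ_ : Set2ω → Set2ω → Set
Y ⊆ₛ X = ∀ n → n ∈ₛ Y → n ∈ₛ X

Infinite : Set2ω → Set
Infinite X = ∀ n → ∃ λ m → n ≤ m × m ∈ₛ X

data PR : ℕ → Set where
  zeroF : ∀ {n} → PR n
  succF : PR 1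
  proj  : ∀ {n} → Fin n → PR n
  comp  : ∀ {n k} → PR k → Vec (PR n) k → PR n
  prec  : ∀ {n} → PR n → PR (suc (suc n)) → PR (suc n)

mutual
  eval : ∀ {n} → PR n → Vec ℕ n → ℕ
  eval zeroF xs = 0
  eval succF (x ∷ []) = suc x
  eval (proj i) xs = lookup xs i
  eval (comp f gs) xs = eval f (evalVec gs xs)
  eval (prec f g) (zero ∷ xs) = eval f xs
  eval (prec f g) (suc y ∷ xs) = eval g (y ∷ eval (prec f g) (y ∷ xs) ∷ xs)

  evalVec : ∀ {n k} → Vec (PR n) k → Vec ℕ n → Vec ℕ k
  evalVec [] xs = []
  evalVec (g ∷ gs) xs = eval g xs ∷ evalVec gs xs

-- The Σ⁰₁ (= c.e.) set with index f : { x | ∃ s. f(x,s) = 0 }.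
_∈W_ : ℕ → PR 2 → Set
x ∈W f = ∃ λ s → eval f (x ∷ s ∷ []) ≡ 0

tri : ℕ → ℕ
tri zero = zero
tri (suc n) = suc n + tri n

⟨_,_⟩ : ℕ → ℕ → ℕ
⟨ x , y ⟩ = tri (x + y) + y

testBit : ℕ → ℕ → Bool
testBit y zero = y % 2 ≡ᵇ 1
testBit y (suc x) = testBit ⌊ y /2⌋ x

D : ℕ → Set2ω
D y x = testBit y x

code : List Bool → ℕ
code [] = 0
code (false ∷ σ) = 1 + 2 * code σ
code (true ∷ σ) = 2 + 2 * code σ

_∈Op_ : ℕ → (PR 2 × Set2ω) → Set
x ∈Op (W Data.Product., B) = ∃ λ y → (⟨ x , y ⟩ ∈W W) × (D y ⊆ₛ B)

OpEq : PR 2 → Set2ω → Set2ω → Set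
OpEq Γ Y X = ∀ x → (x ∈Op (Γ Data.Product., Y) → x ∈ₛ X) × (x ∈ₛ X → x ∈Op (Γ Data.Product., Y))

UniformlyIntroenumerable : Set2ω → Set
UniformlyIntroenumerable X =
  Infinite X × Σ (PR 2) λ Γ → ∀ (Y : Set2ω) → Infinite Y → Y ⊆ₛ X → OpEq Γ Y X

prefix : Set2ω → ℕ → List Bool
prefix X zero = []
prefix X (suc n) = X 0 ∷ prefix (λ k → X (suc k)) n

_≺_ : List Bool → Set2ω → Set
σ ≺ X = prefix X (length σ) ≡ σ

isPrefix : List Bool → List Bool → Bool
isPrefix [] τ = true
isPrefix (b ∷ σ) [] = false
isPrefix (true ∷ σ) (true ∷ τ) = isPrefix σ τ
isPrefix (false ∷ σ) (false ∷ τ) = isPrefix σ τ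
isPrefix (true ∷ σ) (false ∷ τ) = false
isPrefix (false ∷ σ) (true ∷ τ) = false

allStrings : ℕ → List (List Bool)
allStrings zero = [] ∷ []
allStrings (suc n) = map (true ∷_) (allStrings n) ++ map (false ∷_) (allStrings n)

-- number of strings of length n lying in ⋃_{σ ∈ L} [σ];
-- μ(⋃_{σ∈L}[σ]) = sup_n (countCover n L / 2^n)
countCover : ℕ → List (List Bool) → ℕ
countCover n L = length (filterᵇ (λ τ → any (λ σ → isPrefix σ τ) L) (allStrings n))

-- m-th level of the uniformly Σ⁰₁ sequence coded by f:
-- G_m = ⋃ { [σ] | ⟨m, code σ⟩ ∈ W_f }
_∈G[_,_] : Set2ω → PR 2 → ℕ → Set
X ∈G[ f , m ] = ∃ λ σ → (⟨ m , code σ ⟩ ∈W f) × (σ ≺ X)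

-- μ(G_m) ≤ 2^{-m}: every finite subunion has measure ≤ 2^{-m}
-- (measure of an open set = sup of measures of its finite subunions)
MeasureBound : PR 2 → ℕ → Set
MeasureBound f m = ∀ (L : List (List Bool)) → All (λ σ → ⟨ m , code σ ⟩ ∈W f) L →
  ∀ n → countCover n L * 2 ^ m ≤ 2 ^ n

MLTest : PR 2 → Set
MLTest f = ∀ m → MeasureBound f m

MLRandom : Set2ω → Set
MLRandom X = ∀ (f : PR 2) → MLTest f → ¬ (∀ m → X ∈G[ f , m ])

{-# OPTIONS --safe #-}
-- Suppose Γ witnesses that A is uniformly introenumerable and put k = 2m + 1. Since
-- Γ(A ∩ [k, ∞)) = A = Γ(A), every long enough initial segment σ of A has its first k bits
-- determined by the rest: x < k lies in A iff Γ enumerates x, by an axiom and a stage below |σ|,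
-- from a finite subset of σ ∩ [k, |σ|). Such strings form the m-th level of a primitive recursive
-- Martin-Löf test covering A. The head of such a σ is monotone in its tail and in |σ|, so among the
-- strings of length n extending one, those with a common tail have heads forming a chain of subsets
-- of k; there are therefore at most (k + 1) 2^(n − k) ≤ 2^(n − m) of them.
module Submission where

open import Defs

open import Data.Bool using (Bool; true; false; _∧_; if_then_else_; T; T?)
open import Data.Bool.ListAction using (any)
open import Data.Bool.Properties using (T-≡; T-∧)
open import Data.Empty using (⊥-elim)
open import Data.Fin using (Fin; zero; suc; #_; _↑ʳ_; fromℕ<)
import Data.Fin as Fin
open import Data.Fin.Properties using (pigeonhole; fromℕ<-injective)
open import Data.List using (List; []; _∷_; length; drop; map; filterᵇ)
import Data.List as List
open import Data.List.Properties using (length-drop; ∷-injectiveʳ)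
open import Data.List.Membership.Propositional using (_∈_)
open import Data.List.Membership.Propositional.Properties using (∈-lookup; ∈-filter⁻; ∈-map⁻; ∈-++⁻)
open import Data.List.Relation.Unary.All as All using (All; [])
open import Data.List.Relation.Unary.AllPairs using ([]; _∷_)
open import Data.List.Relation.Unary.Any as Any using (here)
open import Data.List.Relation.Unary.Any.Properties using (any⁻)
open import Data.List.Relation.Unary.Unique.Propositional using (Unique)
import Data.List.Relation.Unary.Unique.Propositional.Properties as Unique
open import Data.Nat using (ℕ; zero; suc; _+_; _*_; _∸_; _^_; _≤_; _<_; z≤n; s≤s; pred; ⌊_/2⌋; _%_; _≡ᵇ_; _⊔_;
                            _≤ᵇ_; _≤?_; NonZero)
open import Data.Nat.DivMod using (m*n%n≡0; [m+kn]%n≡m%n; m<n⇒m%n≡m)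
open import Data.Nat.GeneralisedArithmetic using (fold; iterate; iterate-is-fold)
open import Data.Nat.Properties
open import Data.Nat.Tactic.RingSolver using (solve-∀)
open import Data.Product using (_×_; _,_; proj₁; proj₂; ∃-syntax)
open import Data.Product.Function.NonDependent.Propositional using (_×-⇔_)
open import Data.Sum using (_⊎_; inj₁; inj₂; [_,_]′)
open import Data.Vec using (Vec; []; _∷_; lookup; tabulate)
open import Data.Vec.Properties using (tabulate∘lookup)
open import Function.Base using (_∘_)
open import Function.Bundles using (_⇔_; mk⇔; Equivalence)
open import Function.Construct.Composition using (_⇔-∘_)
open import Function.Related.TypeIsomorphisms using (→-cong-⇔)
open import Relation.Binary.Definitions using (tri<; tri≈; tri>)
open import Relation.Binary.PropositionalEquality
open import Relation.Nullary using (¬_; yes; no)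

constPR : ∀ {n} → ℕ → PR n
constPR zero    = zeroF
constPR (suc k) = comp succF (constPR k ∷ [])

eval-constPR : ∀ {n} k (xs : Vec ℕ n) → eval (constPR k) xs ≡ k
eval-constPR zero    xs = refl
eval-constPR (suc k) xs = cong suc (eval-constPR k xs)

addPR : PR 2
addPR = prec (proj (# 0)) (comp succF (proj (# 1) ∷ []))

eval-addPR : ∀ a b → eval addPR (a ∷ b ∷ []) ≡ a + b
eval-addPR zero    b = refl
eval-addPR (suc a) b = cong suc (eval-addPR a b)

mulPR : PR 2
mulPR = prec zeroF (comp addPR (proj (# 2) ∷ proj (# 1) ∷ []))

eval-mulPR : ∀ a b → eval mulPR (a ∷ b ∷ []) ≡ a * b
eval-mulPR zero    b = refl
eval-mulPR (suc a) b = trans (eval-addPR b _) (cong (b +_) (eval-mulPR a b))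

predPR : PR 1
predPR = prec zeroF (proj (# 0))

eval-predPR : ∀ a → eval predPR (a ∷ []) ≡ pred a
eval-predPR zero    = refl
eval-predPR (suc a) = refl

-- prec recurses on its first argument, hence the flipped argument order
flippedMonusPR : PR 2
flippedMonusPR = prec (proj (# 0)) (comp predPR (proj (# 1) ∷ []))

eval-flippedMonusPR : ∀ b a → eval flippedMonusPR (b ∷ a ∷ []) ≡ a ∸ b
eval-flippedMonusPR zero    a = refl
eval-flippedMonusPR (suc b) a =
  trans (eval-predPR (eval flippedMonusPR (b ∷ a ∷ [])))
    (trans (cong pred (eval-flippedMonusPR b a)) (pred[m∸n]≡m∸[1+n] a b))

monusPR : PR 2
monusPR = comp flippedMonusPR (proj (# 1) ∷ proj (# 0) ∷ [])

eval-monusPR : ∀ a b → eval monusPR (a ∷ b ∷ []) ≡ a ∸ b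
eval-monusPR a b = eval-flippedMonusPR b a

triPR : PR 1
triPR = prec zeroF (comp addPR (comp succF (proj (# 0) ∷ []) ∷ proj (# 1) ∷ []))

eval-triPR : ∀ n → eval triPR (n ∷ []) ≡ tri n
eval-triPR zero    = refl
eval-triPR (suc n) = trans (eval-addPR (suc n) _) (cong (suc n +_) (eval-triPR n))

pow2PR : PR 1
pow2PR = prec (constPR 1) (comp mulPR (constPR 2 ∷ proj (# 1) ∷ []))

eval-pow2PR : ∀ n → eval pow2PR (n ∷ []) ≡ 2 ^ n
eval-pow2PR zero    = refl
eval-pow2PR (suc n) = trans (eval-mulPR 2 (eval pow2PR (n ∷ []))) (cong (2 *_) (eval-pow2PR n))

[1+n]%2≡1∸n%2 : ∀ n → suc n % 2 ≡ 1 ∸ n % 2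
[1+n]%2≡1∸n%2 zero          = refl
[1+n]%2≡1∸n%2 (suc zero)    = refl
[1+n]%2≡1∸n%2 (suc (suc n)) = [1+n]%2≡1∸n%2 n

⌊1+n/2⌋≡⌊n/2⌋+n%2 : ∀ n → ⌊ suc n /2⌋ ≡ ⌊ n /2⌋ + n % 2
⌊1+n/2⌋≡⌊n/2⌋+n%2 zero          = refl
⌊1+n/2⌋≡⌊n/2⌋+n%2 (suc zero)    = refl
⌊1+n/2⌋≡⌊n/2⌋+n%2 (suc (suc n)) = cong suc (⌊1+n/2⌋≡⌊n/2⌋+n%2 n)

parityPR : PR 1
parityPR = prec zeroF (comp monusPR (constPR 1 ∷ proj (# 1) ∷ []))

eval-parityPR : ∀ n → eval parityPR (n ∷ []) ≡ n % 2
eval-parityPR zero    = refl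
eval-parityPR (suc n) =
  trans (eval-monusPR 1 (eval parityPR (n ∷ [])))
    (trans (cong (1 ∸_) (eval-parityPR n)) (sym ([1+n]%2≡1∸n%2 n)))

halfPR : PR 1
halfPR = prec zeroF (comp addPR (proj (# 1) ∷ comp parityPR (proj (# 0) ∷ []) ∷ []))

eval-halfPR : ∀ n → eval halfPR (n ∷ []) ≡ ⌊ n /2⌋
eval-halfPR zero    = refl
eval-halfPR (suc n) =
  trans (eval-addPR (eval halfPR (n ∷ [])) _)
    (trans (cong₂ _+_ (eval-halfPR n) (eval-parityPR n)) (sym (⌊1+n/2⌋≡⌊n/2⌋+n%2 n)))

halvingsPR : PR 2
halvingsPR = prec (proj (# 0)) (comp halfPR (proj (# 1) ∷ []))

eval-halvingsPR : ∀ i y → eval halvingsPR (i ∷ y ∷ []) ≡ iterate ⌊_/2⌋ y i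
eval-halvingsPR i y = trans (go i) (iterate-is-fold y ⌊_/2⌋ i)
  where
  go : ∀ i → eval halvingsPR (i ∷ y ∷ []) ≡ fold y ⌊_/2⌋ i
  go zero    = refl
  go (suc i) = trans (eval-halfPR (eval halvingsPR (i ∷ y ∷ []))) (cong ⌊_/2⌋ (go i))

bitPR : PR 2
bitPR = comp parityPR (comp halvingsPR (proj (# 1) ∷ proj (# 0) ∷ []) ∷ [])

eval-bitPR : ∀ y i → eval bitPR (y ∷ i ∷ []) ≡ iterate ⌊_/2⌋ y i % 2
eval-bitPR y i =
  trans (eval-parityPR (eval halvingsPR (i ∷ y ∷ []))) (cong (_% 2) (eval-halvingsPR i y))

testBit≡iterate⌊/2⌋%2 : ∀ y i → testBit y i ≡ (iterate ⌊_/2⌋ y i % 2 ≡ᵇ 1)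
testBit≡iterate⌊/2⌋%2 y zero    = refl
testBit≡iterate⌊/2⌋%2 y (suc i) = testBit≡iterate⌊/2⌋%2 ⌊ y /2⌋ i

foldBelow : (ℕ → ℕ → ℕ) → ℕ → ℕ → (ℕ → ℕ) → ℕ
foldBelow _∙_ ε zero    g = ε
foldBelow _∙_ ε (suc b) g = foldBelow _∙_ ε b g ∙ g b

foldBelow-cong : ∀ {_∙_ ε} b {g h : ℕ → ℕ} → (∀ a → g a ≡ h a) →
                 foldBelow _∙_ ε b g ≡ foldBelow _∙_ ε b h
foldBelow-cong                 zero    g≗h = refl
foldBelow-cong {_∙_} {ε} (suc b) g≗h = cong₂ _∙_ (foldBelow-cong {_∙_} {ε} b g≗h) (g≗h b)

evalVec-tabulate : ∀ {n k} (ps : Fin k → PR n) xs →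
                   evalVec (tabulate ps) xs ≡ tabulate (λ i → eval (ps i) xs)
evalVec-tabulate {k = zero}  ps xs = refl
evalVec-tabulate {k = suc k} ps xs = cong (eval (ps zero) xs ∷_) (evalVec-tabulate (ps ∘ suc) xs)

projections : ∀ {n} → Vec (PR n) n
projections = tabulate proj

evalVec-projections : ∀ {n} (xs : Vec ℕ n) → evalVec projections xs ≡ xs
evalVec-projections xs = trans (evalVec-tabulate proj xs) (tabulate∘lookup xs)

foldBelowPR : ∀ {n} → PR 2 → ℕ → PR (suc n) → PR (suc n)
foldBelowPR op ε body =
  prec (constPR ε)
       (comp op (proj (# 1) ∷ comp body (proj (# 0) ∷ tabulate (λ i → proj (suc (suc i)))) ∷ []))

eval-foldBelowPR : ∀ {n _∙_} {op : PR 2} → (∀ u v → eval op (u ∷ v ∷ []) ≡ u ∙ v) →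
  ∀ ε body b (xs : Vec ℕ n) →
  eval (foldBelowPR op ε body) (b ∷ xs) ≡ foldBelow _∙_ ε b (λ a → eval body (a ∷ xs))
eval-foldBelowPR             op-spec ε body zero    xs = eval-constPR ε xs
eval-foldBelowPR {_∙_ = _∙_} {op} op-spec ε body (suc b) xs =
  trans (op-spec acc _)
    (cong₂ _∙_ (eval-foldBelowPR op-spec ε body b xs) (cong (λ ys → eval body (b ∷ ys)) rest≡xs))
  where
  acc : ℕ
  acc = eval (foldBelowPR op ε body) (b ∷ xs)
  rest≡xs : evalVec (tabulate (λ i → proj (suc (suc i)))) (b ∷ acc ∷ xs) ≡ xs
  rest≡xs = trans (evalVec-tabulate (λ i → proj (suc (suc i))) _) (tabulate∘lookup xs)

-- Bounded formulas and their primitive recursive characteristic functions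

data Tm (n : ℕ) : Set where
  var            : Fin n → Tm n
  lit            : ℕ → Tm n
  _⊕_ _⊖_ _⊗_    : Tm n → Tm n → Tm n
  triangle pow2  : Tm n → Tm n
  bitOf          : Tm n → Tm n → Tm n
  app            : PR 2 → Tm n → Tm n → Tm n
  sumBelow prodBelow : Tm n → Tm (suc n) → Tm n

infixl 6 _⊕_ _⊖_
infixl 7 _⊗_

⟦_⟧ : ∀ {n} → Tm n → Vec ℕ n → ℕ
⟦ var i ⟧         xs = lookup xs i
⟦ lit k ⟧         xs = k
⟦ a ⊕ b ⟧         xs = ⟦ a ⟧ xs + ⟦ b ⟧ xs
⟦ a ⊖ b ⟧         xs = ⟦ a ⟧ xs ∸ ⟦ b ⟧ xs
⟦ a ⊗ b ⟧         xs = ⟦ a ⟧ xs * ⟦ b ⟧ xs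
⟦ triangle a ⟧    xs = tri (⟦ a ⟧ xs)
⟦ pow2 a ⟧        xs = 2 ^ ⟦ a ⟧ xs
⟦ bitOf y i ⟧     xs = iterate ⌊_/2⌋ (⟦ y ⟧ xs) (⟦ i ⟧ xs) % 2
⟦ app p a b ⟧     xs = eval p (⟦ a ⟧ xs ∷ ⟦ b ⟧ xs ∷ [])
⟦ sumBelow b t ⟧  xs = foldBelow _+_ 0 (⟦ b ⟧ xs) (λ a → ⟦ t ⟧ (a ∷ xs))
⟦ prodBelow b t ⟧ xs = foldBelow _*_ 1 (⟦ b ⟧ xs) (λ a → ⟦ t ⟧ (a ∷ xs))

pair : ∀ {n} → Tm n → Tm n → Tm n
pair a b = triangle (a ⊕ b) ⊕ b

compile : ∀ {n} → Tm n → PR n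
compile (var i)         = proj i
compile (lit k)         = constPR k
compile (a ⊕ b)         = comp addPR (compile a ∷ compile b ∷ [])
compile (a ⊖ b)         = comp monusPR (compile a ∷ compile b ∷ [])
compile (a ⊗ b)         = comp mulPR (compile a ∷ compile b ∷ [])
compile (triangle a)    = comp triPR (compile a ∷ [])
compile (pow2 a)        = comp pow2PR (compile a ∷ [])
compile (bitOf y i)     = comp bitPR (compile y ∷ compile i ∷ [])
compile (app p a b)     = comp p (compile a ∷ compile b ∷ [])
compile (sumBelow b t)  = comp (foldBelowPR addPR 0 (compile t)) (compile b ∷ projections)
compile (prodBelow b t) = comp (foldBelowPR mulPR 1 (compile t)) (compile b ∷ projections)

eval-compile-foldBelow : ∀ {n _∙_} (op : PR 2) ε → (∀ u v → eval op (u ∷ v ∷ []) ≡ u ∙ v) →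
  ∀ b t (xs : Vec ℕ n) → eval (comp (foldBelowPR op ε (compile t)) (compile b ∷ projections)) xs
                         ≡ foldBelow _∙_ ε (⟦ b ⟧ xs) (λ a → ⟦ t ⟧ (a ∷ xs))

eval-compile : ∀ {n} (t : Tm n) xs → eval (compile t) xs ≡ ⟦ t ⟧ xs
eval-compile (var i)         xs = refl
eval-compile (lit k)         xs = eval-constPR k xs
eval-compile (a ⊕ b)         xs = trans (eval-addPR (eval (compile a) xs) (eval (compile b) xs))
                                        (cong₂ _+_ (eval-compile a xs) (eval-compile b xs))
eval-compile (a ⊖ b)         xs = trans (eval-monusPR (eval (compile a) xs) (eval (compile b) xs))
                                        (cong₂ _∸_ (eval-compile a xs) (eval-compile b xs))
eval-compile (a ⊗ b)         xs = trans (eval-mulPR (eval (compile a) xs) (eval (compile b) xs))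
                                        (cong₂ _*_ (eval-compile a xs) (eval-compile b xs))
eval-compile (triangle a)    xs = trans (eval-triPR (eval (compile a) xs)) (cong tri (eval-compile a xs))
eval-compile (pow2 a)        xs = trans (eval-pow2PR (eval (compile a) xs)) (cong (2 ^_) (eval-compile a xs))
eval-compile (bitOf y i)     xs = trans (eval-bitPR (eval (compile y) xs) (eval (compile i) xs))
                                        (cong₂ (λ u v → iterate ⌊_/2⌋ u v % 2)
                                               (eval-compile y xs) (eval-compile i xs))
eval-compile (app p a b)     xs = cong₂ (λ u v → eval p (u ∷ v ∷ [])) (eval-compile a xs) (eval-compile b xs)
eval-compile (sumBelow b t)  xs = eval-compile-foldBelow addPR 0 eval-addPR b t xs
eval-compile (prodBelow b t) xs = eval-compile-foldBelow mulPR 1 eval-mulPR b t xs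

eval-compile-foldBelow {_∙_ = _∙_} op ε op-spec b t xs = begin
  eval F (eval (compile b) xs ∷ evalVec projections xs)
    ≡⟨ cong₂ (λ u ys → eval F (u ∷ ys)) (eval-compile b xs) (evalVec-projections xs) ⟩
  eval F (⟦ b ⟧ xs ∷ xs)
    ≡⟨ eval-foldBelowPR op-spec ε (compile t) (⟦ b ⟧ xs) xs ⟩
  foldBelow _∙_ ε (⟦ b ⟧ xs) (λ a → eval (compile t) (a ∷ xs))
    ≡⟨ foldBelow-cong (⟦ b ⟧ xs) (λ a → eval-compile t (a ∷ xs)) ⟩
  foldBelow _∙_ ε (⟦ b ⟧ xs) (λ a → ⟦ t ⟧ (a ∷ xs)) ∎
  where
  open ≡-Reasoning
  F : PR (suc _)
  F = foldBelowPR op ε (compile t)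

data Fm (n : ℕ) : Set where
  _≐_ _≤F_ _∈D_ : Tm n → Tm n → Fm n
  _∧F_ _⇒F_     : Fm n → Fm n → Fm n
  ∃<F ∀<F       : Tm n → Fm (suc n) → Fm n

infix  4 _≐_ _≤F_ _∈D_ _<F_
infixr 3 _∧F_
infixr 2 _⇒F_
infix  2 _⇔F_

⟦_⟧F : ∀ {n} → Fm n → Vec ℕ n → Set
⟦ a ≐ b ⟧F   xs = ⟦ a ⟧ xs ≡ ⟦ b ⟧ xs
⟦ a ≤F b ⟧F  xs = ⟦ a ⟧ xs ≤ ⟦ b ⟧ xs
⟦ i ∈D y ⟧F  xs = ⟦ i ⟧ xs ∈ₛ D (⟦ y ⟧ xs)
⟦ φ ∧F ψ ⟧F  xs = ⟦ φ ⟧F xs × ⟦ ψ ⟧F xs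
⟦ φ ⇒F ψ ⟧F  xs = ⟦ φ ⟧F xs → ⟦ ψ ⟧F xs
⟦ ∃<F b φ ⟧F xs = ∃[ a ] a < ⟦ b ⟧ xs × ⟦ φ ⟧F (a ∷ xs)
⟦ ∀<F b φ ⟧F xs = ∀ a → a < ⟦ b ⟧ xs → ⟦ φ ⟧F (a ∷ xs)

_<F_ : ∀ {n} → Tm n → Tm n → Fm n
a <F b = lit 1 ⊕ a ≤F b

_⇔F_ : ∀ {n} → Fm n → Fm n → Fm n
φ ⇔F ψ = (φ ⇒F ψ) ∧F (ψ ⇒F φ)

characteristic : ∀ {n} → Fm n → Tm n
characteristic (a ≐ b)    = (a ⊖ b) ⊕ (b ⊖ a)
characteristic (a ≤F b)   = a ⊖ b
characteristic (i ∈D y)   = lit 1 ⊖ bitOf y i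
characteristic (φ ∧F ψ)   = characteristic φ ⊕ characteristic ψ
characteristic (φ ⇒F ψ)   = (lit 1 ⊖ characteristic φ) ⊗ characteristic ψ
characteristic (∃<F b φ)  = prodBelow b (characteristic φ)
characteristic (∀<F b φ)  = sumBelow b (characteristic φ)

m∸n+n∸m≡0⇔m≡n : ∀ m n → (m ∸ n) + (n ∸ m) ≡ 0 ⇔ m ≡ n
m∸n+n∸m≡0⇔m≡n m n = mk⇔
  (λ e → ≤-antisym (m∸n≡0⇒m≤n (m+n≡0⇒m≡0 (m ∸ n) e)) (m∸n≡0⇒m≤n (m+n≡0⇒n≡0 (m ∸ n) e)))
  (λ { refl → cong₂ _+_ (n∸n≡0 m) (n∸n≡0 m) })

m∸n≡0⇔m≤n : ∀ m n → m ∸ n ≡ 0 ⇔ m ≤ n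
m∸n≡0⇔m≤n m n = mk⇔ m∸n≡0⇒m≤n m≤n⇒m∸n≡0

1∸n%2≡0⇔n%2≡ᵇ1 : ∀ n → 1 ∸ n % 2 ≡ 0 ⇔ (n % 2 ≡ᵇ 1) ≡ true
1∸n%2≡0⇔n%2≡ᵇ1 zero          = mk⇔ (λ ()) (λ ())
1∸n%2≡0⇔n%2≡ᵇ1 (suc zero)    = mk⇔ (λ _ → refl) (λ _ → refl)
1∸n%2≡0⇔n%2≡ᵇ1 (suc (suc n)) = 1∸n%2≡0⇔n%2≡ᵇ1 n

1∸bit≡0⇔testBit : ∀ y i → 1 ∸ iterate ⌊_/2⌋ y i % 2 ≡ 0 ⇔ testBit y i ≡ true
1∸bit≡0⇔testBit y i = subst (λ b → 1 ∸ iterate ⌊_/2⌋ y i % 2 ≡ 0 ⇔ b ≡ true)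
                             (sym (testBit≡iterate⌊/2⌋%2 y i)) (1∸n%2≡0⇔n%2≡ᵇ1 (iterate ⌊_/2⌋ y i))

m+n≡0⇔m≡0×n≡0 : ∀ m n → m + n ≡ 0 ⇔ (m ≡ 0 × n ≡ 0)
m+n≡0⇔m≡0×n≡0 m n = mk⇔ (λ e → m+n≡0⇒m≡0 m e , m+n≡0⇒n≡0 m e) (λ { (refl , refl) → refl })

[1∸m]*n≡0⇔m≡0⇒n≡0 : ∀ m n → (1 ∸ m) * n ≡ 0 ⇔ (m ≡ 0 → n ≡ 0)
[1∸m]*n≡0⇔m≡0⇒n≡0 zero    n =
  mk⇔ (λ e _ → trans (sym (*-identityˡ n)) e) (λ h → trans (*-identityˡ n) (h refl))
[1∸m]*n≡0⇔m≡0⇒n≡0 (suc m) n = mk⇔ (λ _ ()) (λ _ → cong (_* n) (0∸n≡0 m))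

sumBelow≡0⇔ : ∀ b {g : ℕ → ℕ} {P : ℕ → Set} → (∀ a → g a ≡ 0 ⇔ P a) →
              foldBelow _+_ 0 b g ≡ 0 ⇔ (∀ a → a < b → P a)
sumBelow≡0⇔ zero        g⇔P = mk⇔ (λ _ _ ()) (λ _ → refl)
sumBelow≡0⇔ (suc b) {g} {P} g⇔P = mk⇔ to from
  where
  ih : foldBelow _+_ 0 b g ≡ 0 ⇔ (∀ a → a < b → P a)
  ih = sumBelow≡0⇔ b g⇔P
  to : foldBelow _+_ 0 b g + g b ≡ 0 → ∀ a → a < suc b → P a
  to e a a<1+b with m<1+n⇒m<n∨m≡n a<1+b
  ... | inj₁ a<b  = Equivalence.to ih (m+n≡0⇒m≡0 _ e) a a<b
  ... | inj₂ refl = Equivalence.to (g⇔P a) (m+n≡0⇒n≡0 _ e)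
  from : (∀ a → a < suc b → P a) → foldBelow _+_ 0 b g + g b ≡ 0
  from h = cong₂ _+_ (Equivalence.from ih (λ a a<b → h a (m<n⇒m<1+n a<b)))
                     (Equivalence.from (g⇔P b) (h b (n<1+n b)))

prodBelow≡0⇔ : ∀ b {g : ℕ → ℕ} {P : ℕ → Set} → (∀ a → g a ≡ 0 ⇔ P a) →
               foldBelow _*_ 1 b g ≡ 0 ⇔ (∃[ a ] a < b × P a)
prodBelow≡0⇔ zero        g⇔P = mk⇔ (λ ()) (λ { (_ , () , _) })
prodBelow≡0⇔ (suc b) {g} {P} g⇔P = mk⇔ to from
  where
  Π : ℕ
  Π = foldBelow _*_ 1 b g
  ih : Π ≡ 0 ⇔ (∃[ a ] a < b × P a)
  ih = prodBelow≡0⇔ b g⇔P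
  to : Π * g b ≡ 0 → ∃[ a ] a < suc b × P a
  to e with m*n≡0⇒m≡0∨n≡0 Π e
  ... | inj₁ e′ = let (a , a<b , pa) = Equivalence.to ih e′ in a , m<n⇒m<1+n a<b , pa
  ... | inj₂ e′ = b , n<1+n b , Equivalence.to (g⇔P b) e′
  from : (∃[ a ] a < suc b × P a) → Π * g b ≡ 0
  from (a , a<1+b , pa) with m<1+n⇒m<n∨m≡n a<1+b
  ... | inj₁ a<b  = cong (_* g b) (Equivalence.from ih (a , a<b , pa))
  ... | inj₂ refl = trans (cong (Π *_) (Equivalence.from (g⇔P a) pa)) (*-zeroʳ Π)

characteristic≡0⇔ : ∀ {n} (φ : Fm n) xs → ⟦ characteristic φ ⟧ xs ≡ 0 ⇔ ⟦ φ ⟧F xs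
characteristic≡0⇔ (a ≐ b)   xs = m∸n+n∸m≡0⇔m≡n (⟦ a ⟧ xs) (⟦ b ⟧ xs)
characteristic≡0⇔ (a ≤F b)  xs = m∸n≡0⇔m≤n (⟦ a ⟧ xs) (⟦ b ⟧ xs)
characteristic≡0⇔ (i ∈D y)  xs = 1∸bit≡0⇔testBit (⟦ y ⟧ xs) (⟦ i ⟧ xs)
characteristic≡0⇔ (φ ∧F ψ)  xs =
  (characteristic≡0⇔ φ xs ×-⇔ characteristic≡0⇔ ψ xs) ⇔-∘ m+n≡0⇔m≡0×n≡0 _ _
characteristic≡0⇔ (φ ⇒F ψ)  xs =
  →-cong-⇔ (characteristic≡0⇔ φ xs) (characteristic≡0⇔ ψ xs) ⇔-∘ [1∸m]*n≡0⇔m≡0⇒n≡0 _ _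
characteristic≡0⇔ (∃<F b φ) xs = prodBelow≡0⇔ (⟦ b ⟧ xs) (λ a → characteristic≡0⇔ φ (a ∷ xs))
characteristic≡0⇔ (∀<F b φ) xs = sumBelow≡0⇔ (⟦ b ⟧ xs) (λ a → characteristic≡0⇔ φ (a ∷ xs))

compile-characteristic≡0⇔ : ∀ {n} (φ : Fm n) xs →
                            eval (compile (characteristic φ)) xs ≡ 0 ⇔ ⟦ φ ⟧F xs
compile-characteristic≡0⇔ φ xs =
  subst (λ v → v ≡ 0 ⇔ ⟦ φ ⟧F xs) (sym (eval-compile (characteristic φ) xs)) (characteristic≡0⇔ φ xs)

bits : List Bool → Set2ω
bits []      i       = false
bits (b ∷ σ) zero    = b
bits (b ∷ σ) (suc i) = bits σ i

-- least significant bit first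
fromBits : List Bool → ℕ
fromBits []          = 0
fromBits (false ∷ σ) = fromBits σ * 2
fromBits (true ∷ σ)  = suc (fromBits σ * 2)

testBit-0 : ∀ i → testBit 0 i ≡ false
testBit-0 zero    = refl
testBit-0 (suc i) = testBit-0 i

⌊n*2/2⌋≡n : ∀ n → ⌊ n * 2 /2⌋ ≡ n
⌊n*2/2⌋≡n zero    = refl
⌊n*2/2⌋≡n (suc n) = cong suc (⌊n*2/2⌋≡n n)

⌊1+n*2/2⌋≡n : ∀ n → ⌊ suc (n * 2) /2⌋ ≡ n
⌊1+n*2/2⌋≡n zero    = refl
⌊1+n*2/2⌋≡n (suc n) = cong suc (⌊1+n*2/2⌋≡n n)

testBit-fromBits : ∀ σ i → testBit (fromBits σ) i ≡ bits σ i
testBit-fromBits []          i       = testBit-0 i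
testBit-fromBits (false ∷ σ) zero    = cong (_≡ᵇ 1) (m*n%n≡0 (fromBits σ) 2)
testBit-fromBits (true ∷ σ)  zero    = cong (_≡ᵇ 1) ([m+kn]%n≡m%n 1 (fromBits σ) 2)
testBit-fromBits (false ∷ σ) (suc i) =
  trans (cong (λ y → testBit y i) (⌊n*2/2⌋≡n (fromBits σ))) (testBit-fromBits σ i)
testBit-fromBits (true ∷ σ)  (suc i) =
  trans (cong (λ y → testBit y i) (⌊1+n*2/2⌋≡n (fromBits σ))) (testBit-fromBits σ i)

fromBits< : ∀ σ → fromBits σ < 2 ^ length σ
fromBits<-∷ : ∀ σ → suc (suc (fromBits σ * 2)) ≤ 2 ^ suc (length σ)

fromBits< []          = s≤s z≤n
fromBits< (false ∷ σ) = ≤-trans (n≤1+n _) (fromBits<-∷ σ)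
fromBits< (true ∷ σ)  = fromBits<-∷ σ

fromBits<-∷ σ = ≤-trans (*-monoˡ-≤ 2 (fromBits< σ)) (≤-reflexive (*-comm (2 ^ length σ) 2))

code+1≡2^length+fromBits : ∀ σ → code σ + 1 ≡ 2 ^ length σ + fromBits σ
code+1≡2^length+fromBits []          = refl
code+1≡2^length+fromBits (false ∷ σ) =
  trans (shift (code σ))
    (trans (cong (_* 2) (code+1≡2^length+fromBits σ)) (distrib (2 ^ length σ) (fromBits σ)))
  where
  shift : ∀ c → 1 + 2 * c + 1 ≡ (c + 1) * 2
  shift = solve-∀
  distrib : ∀ p v → (p + v) * 2 ≡ 2 * p + v * 2
  distrib = solve-∀
code+1≡2^length+fromBits (true ∷ σ)  =
  trans (shift (code σ))
    (trans (cong (λ c → suc (c * 2)) (code+1≡2^length+fromBits σ)) (distrib (2 ^ length σ) (fromBits σ)))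
  where
  shift : ∀ c → 2 + 2 * c + 1 ≡ suc ((c + 1) * 2)
  shift = solve-∀
  distrib : ∀ p v → suc ((p + v) * 2) ≡ 2 * p + suc (v * 2)
  distrib = solve-∀

-- code σ + 1 = 2 ^ length σ + fromBits σ, so subtracting 2 ^ length σ leaves the bits of σ
decode : ℕ → ℕ → ℕ
decode c N = c + 1 ∸ 2 ^ N

CodeOfLength : ℕ → ℕ → Set
CodeOfLength c N = 2 ^ N ≤ c + 1 × c + 1 < 2 ^ suc N

decode-code : ∀ σ → decode (code σ) (length σ) ≡ fromBits σ
decode-code σ =
  trans (cong (_∸ 2 ^ length σ) (code+1≡2^length+fromBits σ)) (m+n∸m≡n (2 ^ length σ) (fromBits σ))

code-ofLength : ∀ σ → CodeOfLength (code σ) (length σ)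
code-ofLength σ = ≤-trans (m≤m+n p (fromBits σ)) (≤-reflexive (sym c+1≡p+v)) , (begin-strict
  code σ + 1     ≡⟨ c+1≡p+v ⟩
  p + fromBits σ <⟨ +-monoʳ-< p (fromBits< σ) ⟩
  p + p          ≡⟨ cong (p +_) (sym (+-identityʳ p)) ⟩
  2 * p          ∎)
  where
  open ≤-Reasoning
  p : ℕ
  p = 2 ^ length σ
  c+1≡p+v : code σ + 1 ≡ p + fromBits σ
  c+1≡p+v = code+1≡2^length+fromBits σ

2^-cancel-< : ∀ {a b} → 2 ^ a < 2 ^ b → a < b
2^-cancel-< 2^a<2^b = ≰⇒> (λ b≤a → <⇒≱ 2^a<2^b (^-monoʳ-≤ 2 b≤a))

CodeOfLength-unique : ∀ {c N N′} → CodeOfLength c N → CodeOfLength c N′ → N ≡ N′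
CodeOfLength-unique (2^N≤ , <2^1+N) (2^N′≤ , <2^1+N′) =
  ≤-antisym (≤-pred (2^-cancel-< (≤-<-trans 2^N≤ <2^1+N′)))
            (≤-pred (2^-cancel-< (≤-<-trans 2^N′≤ <2^1+N)))

tri-mono-≤ : ∀ {a b} → a ≤ b → tri a ≤ tri b
tri-mono-≤ {zero}          _         = z≤n
tri-mono-≤ {suc a} {suc b} (s≤s a≤b) = +-mono-≤ (s≤s a≤b) (tri-mono-≤ a≤b)

-- the pairs ⟨ x , y ⟩ with x + y = s fill the interval [tri s, tri (suc s))
tri+y<tri+y′ : ∀ {s s′ y y′} → y ≤ s → s < s′ → tri s + y < tri s′ + y′
tri+y<tri+y′ {s} {s′} {y} {y′} y≤s s<s′ = begin-strict
  tri s + y    ≤⟨ +-monoʳ-≤ (tri s) y≤s ⟩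
  tri s + s    ≡⟨ +-comm (tri s) s ⟩
  s + tri s    <⟨ n<1+n (s + tri s) ⟩
  tri (suc s)  ≤⟨ tri-mono-≤ s<s′ ⟩
  tri s′       ≤⟨ m≤m+n (tri s′) y′ ⟩
  tri s′ + y′  ∎
  where open ≤-Reasoning

tri+y-injective : ∀ {s s′ y y′} → y ≤ s → y′ ≤ s′ → tri s + y ≡ tri s′ + y′ → s ≡ s′ × y ≡ y′
tri+y-injective {s} {s′} y≤s y′≤s′ eq with <-cmp s s′
... | tri< s<s′ _ _ = ⊥-elim (<⇒≢ (tri+y<tri+y′ y≤s s<s′) eq)
... | tri> _ _ s′<s = ⊥-elim (<⇒≢ (tri+y<tri+y′ y′≤s′ s′<s) (sym eq))
... | tri≈ _ refl _ = refl , +-cancelˡ-≡ (tri s) _ _ eq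

⟨,⟩-injective : ∀ {x y x′ y′} → ⟨ x , y ⟩ ≡ ⟨ x′ , y′ ⟩ → x ≡ x′ × y ≡ y′
⟨,⟩-injective {x} {y} {x′} {y′} eq =
  let x+y≡x′+y′ , y≡y′ = tri+y-injective {x + y} {x′ + y′} (m≤n+m y x) (m≤n+m y′ x′) eq
  in +-cancelʳ-≡ y x x′ (trans x+y≡x′+y′ (cong (x′ +_) (sym y≡y′))) , y≡y′

testBit-< : ∀ y i → i ∈ₛ D y → i < y
testBit-< zero    i       i∈D0 = ⊥-elim (false≢true (trans (sym (testBit-0 i)) i∈D0))
  where
  false≢true : false ≢ true
  false≢true ()
testBit-< (suc y) zero    _    = s≤s z≤n
testBit-< (suc y) (suc i) i∈Dy = s≤s (≤-trans (testBit-< ⌊ suc y /2⌋ i i∈Dy) (≤-pred (⌊n/2⌋<n y)))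

-- Strings whose head is enumerated from their tail

-- Γ enumerates x from S ∩ [k, ∞) by an axiom ⟨ x , y ⟩ found at stage t, both below N;
-- bounding i by y loses nothing since D y ⊆ [0, y)
EnumeratedWithin : PR 2 → ℕ → ℕ → Set2ω → ℕ → Set
EnumeratedWithin Γ k N S x =
  ∃[ y ] y < N × ∃[ t ] t < N × eval Γ (⟨ x , y ⟩ ∷ t ∷ []) ≡ 0 ×
  (∀ i → i < y → i ∈ₛ D y → k ≤ i × i ∈ₛ S)

HeadEnumerated : PR 2 → ℕ → ℕ → Set2ω → Set
HeadEnumerated Γ k N S =
  k ≤ N × (∀ x → x < k → (x ∈ₛ S → EnumeratedWithin Γ k N S x) × (EnumeratedWithin Γ k N S x → x ∈ₛ S))

NestedBelow : ℕ → Set2ω → Set2ω → Set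
NestedBelow k S S′ = ∀ x → x < k → x ∈ₛ S → x ∈ₛ S′

module _ (Γ : PR 2) {k : ℕ} where

  EnumeratedWithin-mono : ∀ {N N′ S x} → N ≤ N′ →
                          EnumeratedWithin Γ k N S x → EnumeratedWithin Γ k N′ S x
  EnumeratedWithin-mono N≤N′ (y , y<N , t , t<N , axiom , D⊆S) =
    y , <-≤-trans y<N N≤N′ , t , <-≤-trans t<N N≤N′ , axiom , D⊆S

  EnumeratedWithin-cong : ∀ {N S S′ x} → (∀ i → k ≤ i → i < N → S i ≡ S′ i) →
                          EnumeratedWithin Γ k N S x → EnumeratedWithin Γ k N S′ x
  EnumeratedWithin-cong {S′ = S′} S≗S′ (y , y<N , t , t<N , axiom , D⊆S) =
    y , y<N , t , t<N , axiom , D⊆S′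
    where
    D⊆S′ : ∀ i → i < y → i ∈ₛ D y → k ≤ i × i ∈ₛ S′
    D⊆S′ i i<y i∈Dy with k≤i , i∈S ← D⊆S i i<y i∈Dy =
      k≤i , trans (sym (S≗S′ i k≤i (<-trans i<y y<N))) i∈S

  HeadEnumerated-cong : ∀ {N S S′} → (∀ i → i < N → S i ≡ S′ i) →
                        HeadEnumerated Γ k N S → HeadEnumerated Γ k N S′
  HeadEnumerated-cong {N} S≗S′ (k≤N , head) = k≤N , λ x x<k →
      (λ x∈S′ → EnumeratedWithin-cong {x = x} (λ i _ → S≗S′ i)
                  (proj₁ (head x x<k) (trans (S≗S′ x (x<N x<k)) x∈S′)))
    , (λ enum → trans (sym (S≗S′ x (x<N x<k)))
                      (proj₂ (head x x<k) (EnumeratedWithin-cong {x = x} (λ i _ → sym ∘ S≗S′ i) enum)))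
    where
    x<N : ∀ {x} → x < k → x < N
    x<N x<k = <-≤-trans x<k k≤N

  -- Γ reads the head off the tail, and a larger N only admits more axioms
  HeadEnumerated-nested : ∀ {N N′ S S′} → HeadEnumerated Γ k N S → HeadEnumerated Γ k N′ S′ → N ≤ N′ →
                          (∀ i → k ≤ i → S i ≡ S′ i) → NestedBelow k S S′
  HeadEnumerated-nested (_ , head) (_ , head′) N≤N′ tail≡ x x<k x∈S =
    proj₂ (head′ x x<k) (EnumeratedWithin-mono {x = x} N≤N′
      (EnumeratedWithin-cong {x = x} (λ i k≤i _ → tail≡ i k≤i) (proj₁ (head x x<k) x∈S)))

  HeadEnumerated-comparable : ∀ {N N′ S S′} → HeadEnumerated Γ k N S → HeadEnumerated Γ k N′ S′ →
                              (∀ i → k ≤ i → S i ≡ S′ i) → NestedBelow k S S′ ⊎ NestedBelow k S′ S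
  HeadEnumerated-comparable {N} {N′} head head′ tail≡ with ≤-total N N′
  ... | inj₁ N≤N′ = inj₁ (HeadEnumerated-nested head head′ N≤N′ tail≡)
  ... | inj₂ N′≤N = inj₂ (HeadEnumerated-nested head′ head N′≤N (λ i k≤i → sym (tail≡ i k≤i)))

-- The Martin-Löf test

-- k = 2m + 1 makes the (k + 1) 2^(n − k) strings of length n counted below have measure ≤ 2^−m
headLength : ℕ → ℕ
headLength m = suc (m + m)

-- z = ⟨ m , c ⟩ enters level m when c codes a string satisfying HeadEnumerated; s bounds the search
TestWitness : PR 2 → ℕ → ℕ → Set
TestWitness Γ z s =
  ∃[ m ] m < s × ∃[ c ] c < s × ∃[ N ] N < s ×
  z ≡ ⟨ m , c ⟩ × CodeOfLength c N × HeadEnumerated Γ (headLength m) N (D (decode c N))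

module TestFormula (Γ : PR 2) where

  headLengthT : ∀ {n} → Fin n → Tm n
  headLengthT m = lit 1 ⊕ (var m ⊕ var m)

  decodeT : ∀ {n} → Fin n → Fin n → Tm n
  decodeT c N = var c ⊕ lit 1 ⊖ pow2 (var N)

  codeOfLengthF : ∀ {n} → Fin n → Fin n → Fm n
  codeOfLengthF c N = pow2 (var N) ≤F var c ⊕ lit 1 ∧F var c ⊕ lit 1 <F pow2 (lit 1 ⊕ var N)

  -- the de Bruijn variables m, c, N, x stand for headLength m, D (decode c N), N and x
  enumeratedWithinF : ∀ {n} → Fin n → Fin n → Fin n → Fin n → Fm n
  enumeratedWithinF m c N x =
    ∃<F (var N) (∃<F (var (suc N))
      (app Γ (pair (var (2 ↑ʳ x)) (var (# 1))) (var (# 0)) ≐ lit 0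
       ∧F ∀<F (var (# 1))
            (var (# 0) ∈D var (# 2)
             ⇒F headLengthT (3 ↑ʳ m) ≤F var (# 0) ∧F var (# 0) ∈D decodeT (3 ↑ʳ c) (3 ↑ʳ N))))

  headEnumeratedF : ∀ {n} → Fin n → Fin n → Fin n → Fm n
  headEnumeratedF m c N =
    headLengthT m ≤F var N
    ∧F ∀<F (headLengthT m)
         (var (# 0) ∈D decodeT (suc c) (suc N) ⇔F enumeratedWithinF (suc m) (suc c) (suc N) (# 0))

  testF : Fm 2
  testF = ∃<F (var (# 1)) (∃<F (var (# 2)) (∃<F (var (# 3))
            (var (# 3) ≐ pair (var (# 2)) (var (# 1))
             ∧F codeOfLengthF (# 1) (# 0)
             ∧F headEnumeratedF (# 2) (# 1) (# 0))))

-- eval-test≡0⇔ holds by computation: ⟦ testF Γ ⟧F (z ∷ s ∷ []) unfolds to TestWitness Γ z s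
opaque
  test : PR 2 → PR 2
  test Γ = compile (characteristic (TestFormula.testF Γ))

  eval-test≡0⇔ : ∀ Γ z s → eval (test Γ) (z ∷ s ∷ []) ≡ 0 ⇔ TestWitness Γ z s
  eval-test≡0⇔ Γ z s = compile-characteristic≡0⇔ (TestFormula.testF Γ) (z ∷ s ∷ [])

bits-decode-code : ∀ σ i → D (decode (code σ) (length σ)) i ≡ bits σ i
bits-decode-code σ i = trans (cong (λ y → testBit y i) (decode-code σ)) (testBit-fromBits σ i)

∈W-test⇔ : ∀ Γ m σ → ⟨ m , code σ ⟩ ∈W test Γ ⇔ HeadEnumerated Γ (headLength m) (length σ) (bits σ)
∈W-test⇔ Γ m σ = mk⇔ to from
  where
  c N : ℕ
  c = code σ
  N = length σ

  to : ⟨ m , c ⟩ ∈W test Γ → HeadEnumerated Γ (headLength m) N (bits σ)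
  to (s , e)
    with m′ , _ , c′ , _ , N′ , _ , pair≡ , ofLength , head ← Equivalence.to (eval-test≡0⇔ Γ _ s) e
    with refl , refl ← ⟨,⟩-injective {m} {c} {m′} {c′} pair≡
    with refl ← CodeOfLength-unique {c} {N} {N′} (code-ofLength σ) ofLength
    = HeadEnumerated-cong Γ (λ i _ → bits-decode-code σ i) head

  from : HeadEnumerated Γ (headLength m) N (bits σ) → ⟨ m , c ⟩ ∈W test Γ
  from head = s , Equivalence.from (eval-test≡0⇔ Γ _ s)
    (m , m<s , c , c<s , N , N<s , refl , code-ofLength σ ,
     HeadEnumerated-cong Γ (λ i _ → sym (bits-decode-code σ i)) head)
    where
    s : ℕ
    s = suc (m + c + N)
    m<s : m < s
    m<s = s≤s (≤-trans (m≤m+n m c) (m≤m+n (m + c) N))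
    c<s : c < s
    c<s = s≤s (≤-trans (m≤n+m c m) (m≤m+n (m + c) N))
    N<s : N < s
    N<s = s≤s (m≤n+m N (m + c))

-- Covering a uniformly introenumerable set

length-prefix : ∀ X N → length (prefix X N) ≡ N
length-prefix X zero    = refl
length-prefix X (suc N) = cong suc (length-prefix (λ k → X (suc k)) N)

bits-prefix : ∀ X N i → i < N → bits (prefix X N) i ≡ X i
bits-prefix X (suc N) zero    _         = refl
bits-prefix X (suc N) (suc i) (s≤s i<N) = bits-prefix (λ k → X (suc k)) N i i<N

common-bound : ∀ {P : ℕ → ℕ → Set} → (∀ {x N N′} → N ≤ N′ → P x N → P x N′) →
               ∀ k → (∀ x → x < k → ∃[ N ] P x N) → ∃[ N ] ∀ x → x < k → P x N
common-bound mono zero    bounds = 0 , λ _ ()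
common-bound mono (suc k) bounds
  with N , below ← common-bound mono k (λ x x<k → bounds x (m<n⇒m<1+n x<k))
     | Nₖ , at ← bounds k (n<1+n k)
  = N ⊔ Nₖ , λ x x<1+k → [ (λ x<k → mono (m≤m⊔n N Nₖ) (below x x<k))
                         , (λ { refl → mono (m≤n⊔m N Nₖ) at }) ]′ (m<1+n⇒m<n∨m≡n x<1+k)

above : ℕ → Set2ω → Set2ω
above k X i = X i ∧ (k ≤ᵇ i)

above-infinite : ∀ {X} k → Infinite X → Infinite (above k X)
above-infinite {X} k X-infinite n with j , n+k≤j , j∈X ← X-infinite (n + k) =
  j , ≤-trans (m≤m+n n k) n+k≤j ,
  subst (λ b → b ∧ (k ≤ᵇ j) ≡ true) (sym j∈X) (Equivalence.to T-≡ (≤⇒≤ᵇ k≤j))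
  where
  k≤j : k ≤ j
  k≤j = ≤-trans (m≤n+m k n) n+k≤j

above-⊆ : ∀ {X} k → above k X ⊆ₛ X
above-⊆ {X} k i i∈ = Equivalence.to T-≡ (proj₁ (Equivalence.to T-∧ (Equivalence.from T-≡ i∈)))

above-≤ : ∀ {X} k i → i ∈ₛ above k X → k ≤ i
above-≤ {X} k i i∈ = ≤ᵇ⇒≤ k i (proj₂ (Equivalence.to T-∧ (Equivalence.from T-≡ i∈)))

module _ {Γ : PR 2} {A : Set2ω} (A-infinite : Infinite A)
         (Γ-uniform : ∀ Y → Infinite Y → Y ⊆ₛ A → OpEq Γ Y A) where

  -- Γ(A ∩ [k, ∞)) = A supplies the axioms for the head, Γ(A) = A shows that nothing else is enumerated
  module _ (k : ℕ) where

    ∈⇒enumeratedWithin : ∀ x → x ∈ₛ A → ∃[ N ] EnumeratedWithin Γ k N A x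
    ∈⇒enumeratedWithin x x∈A
      with y , (t , axiom) , Dy⊆ ← proj₂ (Γ-uniform (above k A) (above-infinite k A-infinite) (above-⊆ k) x) x∈A =
      suc (y ⊔ t) , y , s≤s (m≤m⊔n y t) , t , s≤s (m≤n⊔m y t) , axiom ,
      λ i _ i∈Dy → above-≤ {A} k i (Dy⊆ i i∈Dy) , above-⊆ {A} k i (Dy⊆ i i∈Dy)

    enumeratedWithin-bound : ∀ x → x < k → ∃[ N ] (x ∈ₛ A → EnumeratedWithin Γ k N A x)
    enumeratedWithin-bound x _ with A x in Ax
    ... | true  = let N , enum = ∈⇒enumeratedWithin x Ax in N , λ _ → enum
    ... | false = 0 , λ ()

    enumeratedWithin⇒∈ : ∀ {x N} → EnumeratedWithin Γ k N A x → x ∈ₛ A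
    enumeratedWithin⇒∈ {x} (y , _ , t , _ , axiom , Dy⊆) =
      proj₁ (Γ-uniform A A-infinite (λ _ i∈A → i∈A) x)
            (y , (t , axiom) , λ i i∈Dy → proj₂ (Dy⊆ i (testBit-< y i i∈Dy) i∈Dy))

    ∃headEnumerated : ∃[ N ] HeadEnumerated Γ k N A
    ∃headEnumerated
      with N , below ← common-bound (λ {x} N≤N′ p x∈A → EnumeratedWithin-mono Γ {x = x} N≤N′ (p x∈A))
                                    k enumeratedWithin-bound =
      N ⊔ k , m≤n⊔m N k ,
      λ x x<k → (λ x∈A → EnumeratedWithin-mono Γ {x = x} (m≤m⊔n N k) (below x x<k x∈A)) , enumeratedWithin⇒∈

  ∈test : ∀ m → A ∈G[ test Γ , m ]
  ∈test m with N , head ← ∃headEnumerated (headLength m) =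
    σ , Equivalence.from (∈W-test⇔ Γ m σ) head′ , cong (prefix A) (length-prefix A N)
    where
    σ : List Bool
    σ = prefix A N
    head′ : HeadEnumerated Γ (headLength m) (length σ) (bits σ)
    head′ = subst (λ L → HeadEnumerated Γ (headLength m) L (bits σ)) (sym (length-prefix A N))
                  (HeadEnumerated-cong Γ (λ i i<N → sym (bits-prefix A N i i<N)) head)

-- Counting strings whose heads form chains

NestedBelow-pred : ∀ {k S S′} → NestedBelow (suc k) S S′ → NestedBelow k S S′
NestedBelow-pred S⊆S′ x x<k = S⊆S′ x (m<n⇒m<1+n x<k)

countBelow : ℕ → Set2ω → ℕ
countBelow zero    S = 0
countBelow (suc k) S = countBelow k S + (if S k then 1 else 0)

countBelow≤ : ∀ k S → countBelow k S ≤ k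
countBelow≤ zero    S = z≤n
countBelow≤ (suc k) S with S k
... | true  = ≤-trans (≤-reflexive (+-comm (countBelow k S) 1)) (s≤s (countBelow≤ k S))
... | false = ≤-trans (≤-reflexive (+-identityʳ (countBelow k S))) (m≤n⇒m≤1+n (countBelow≤ k S))

indicator-mono : ∀ {b b′} → (b ≡ true → b′ ≡ true) → (if b then 1 else 0) ≤ (if b′ then 1 else 0)
indicator-mono {true}  {true}  _ = ≤-refl
indicator-mono {true}  {false} b⇒b′ with () ← b⇒b′ refl
indicator-mono {false}         _ = z≤n

indicator-injective : ∀ {b b′} → (if b then 1 else 0) ≡ (if b′ then 1 else 0) → b ≡ b′
indicator-injective {true}  {true}  _ = refl
indicator-injective {false} {false} _ = refl

countBelow-mono : ∀ k {S S′} → NestedBelow k S S′ → countBelow k S ≤ countBelow k S′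
countBelow-mono zero    _   = z≤n
countBelow-mono (suc k) S⊆S′ =
  +-mono-≤ (countBelow-mono k (NestedBelow-pred S⊆S′)) (indicator-mono (S⊆S′ k (n<1+n k)))

+-≤-≡ : ∀ {a a′ b b′} → a ≤ a′ → b ≤ b′ → a + b ≡ a′ + b′ → a ≡ a′ × b ≡ b′
+-≤-≡ {a} {a′} {b} {b′} a≤a′ b≤b′ eq = a≡a′ , +-cancelˡ-≡ a b b′ (trans eq (cong (_+ b′) (sym a≡a′)))
  where
  a≡a′ : a ≡ a′
  a≡a′ = ≤-antisym a≤a′ (+-cancelʳ-≤ b a′ a (≤-trans (+-monoʳ-≤ a′ b≤b′) (≤-reflexive (sym eq))))

countBelow-nested-≡ : ∀ k {S S′} → NestedBelow k S S′ → countBelow k S ≡ countBelow k S′ →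
                      ∀ x → x < k → S x ≡ S′ x
countBelow-nested-≡ (suc k) S⊆S′ eq x x<1+k
  with count≡ , indicator≡ ← +-≤-≡ (countBelow-mono k (NestedBelow-pred S⊆S′))
                                    (indicator-mono (S⊆S′ k (n<1+n k))) eq
  with m<1+n⇒m<n∨m≡n x<1+k
... | inj₁ x<k  = countBelow-nested-≡ k (NestedBelow-pred S⊆S′) count≡ x x<k
... | inj₂ refl = indicator-injective indicator≡

bits-drop : ∀ k τ j → bits (drop k τ) j ≡ bits τ (k + j)
bits-drop zero    τ       j = refl
bits-drop (suc k) []      j = refl
bits-drop (suc k) (b ∷ τ) j = bits-drop k τ j

fromBits-drop-injective : ∀ k τ τ′ → fromBits (drop k τ) ≡ fromBits (drop k τ′) →
                          ∀ i → k ≤ i → bits τ i ≡ bits τ′ i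
fromBits-drop-injective k τ τ′ eq i k≤i = begin
  bits τ i                              ≡⟨ cong (bits τ) (sym (m+[n∸m]≡n k≤i)) ⟩
  bits τ (k + (i ∸ k))                  ≡⟨ sym (bits-drop k τ (i ∸ k)) ⟩
  bits (drop k τ) (i ∸ k)               ≡⟨ sym (testBit-fromBits (drop k τ) (i ∸ k)) ⟩
  testBit (fromBits (drop k τ)) (i ∸ k)  ≡⟨ cong (λ y → testBit y (i ∸ k)) eq ⟩
  testBit (fromBits (drop k τ′)) (i ∸ k) ≡⟨ testBit-fromBits (drop k τ′) (i ∸ k) ⟩
  bits (drop k τ′) (i ∸ k)              ≡⟨ bits-drop k τ′ (i ∸ k) ⟩
  bits τ′ (k + (i ∸ k))                 ≡⟨ cong (bits τ′) (m+[n∸m]≡n k≤i) ⟩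
  bits τ′ i                             ∎
  where open ≡-Reasoning

bits-injective : ∀ τ τ′ → length τ ≡ length τ′ → (∀ i → bits τ i ≡ bits τ′ i) → τ ≡ τ′
bits-injective []      []        _   _     = refl
bits-injective (b ∷ τ) (b′ ∷ τ′) len bits≡ =
  cong₂ _∷_ (bits≡ zero) (bits-injective τ τ′ (suc-injective len) (λ i → bits≡ (suc i)))

+-*-injective : ∀ M .{{_ : NonZero M}} {v v′ a a′} → v < M → v′ < M →
                v + a * M ≡ v′ + a′ * M → v ≡ v′ × a ≡ a′
+-*-injective M {v} {v′} {a} {a′} v<M v′<M eq =
  v≡v′ , *-cancelʳ-≡ a a′ M (+-cancelˡ-≡ v (a * M) (a′ * M) (trans eq (cong (_+ a′ * M) (sym v≡v′))))
  where
  open ≡-Reasoning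
  v≡v′ : v ≡ v′
  v≡v′ = begin
    v                ≡⟨ sym (m<n⇒m%n≡m v<M) ⟩
    v % M            ≡⟨ sym ([m+kn]%n≡m%n v a M) ⟩
    (v + a * M) % M   ≡⟨ cong (_% M) eq ⟩
    (v′ + a′ * M) % M ≡⟨ [m+kn]%n≡m%n v′ a′ M ⟩
    v′ % M           ≡⟨ m<n⇒m%n≡m v′<M ⟩
    v′               ∎

lookup-distinct : ∀ {A : Set} {xs : List A} → Unique xs →
                  ∀ {i j} → i Fin.< j → List.lookup xs i ≢ List.lookup xs j
lookup-distinct (x≢xs ∷ _)   {zero}  {suc j} _         = All.lookup x≢xs (∈-lookup j)
lookup-distinct (_ ∷ unique) {suc i} {suc j} (s≤s i<j) = lookup-distinct unique i<j

length≤-of-injection : ∀ {A : Set} {xs : List A} (f : A → ℕ) {M} → Unique xs →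
  (∀ {a b} → a ∈ xs → b ∈ xs → f a ≡ f b → a ≡ b) → (∀ {a} → a ∈ xs → f a < M) → length xs ≤ M
length≤-of-injection {xs = xs} f {M} unique injective bounded with length xs ≤? M
... | yes ≤M = ≤M
... | no  ≰M with i , j , i<j , fi≡fj ← pigeonhole (≰⇒> ≰M) (λ i → fromℕ< (bounded (∈-lookup i))) =
  ⊥-elim (lookup-distinct unique i<j (injective (∈-lookup i) (∈-lookup j) (fromℕ<-injective _ _ _ _ fi≡fj)))

length≡0-if-empty : ∀ {A : Set} (xs : List A) → (∀ {x} → ¬ x ∈ xs) → length xs ≡ 0
length≡0-if-empty []       _     = refl
length≡0-if-empty (x ∷ xs) empty = ⊥-elim (empty (here refl))

-- τ ↦ (tail of τ from k, size of its head) is injective, as heads with a common tail form a chain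
length≤-of-nested-heads : ∀ k n (Ts : List (List Bool)) → Unique Ts → (∀ {τ} → τ ∈ Ts → length τ ≡ n) →
  (∀ {τ τ′} → τ ∈ Ts → τ′ ∈ Ts → (∀ i → k ≤ i → bits τ i ≡ bits τ′ i) →
     NestedBelow k (bits τ) (bits τ′) ⊎ NestedBelow k (bits τ′) (bits τ)) →
  length Ts ≤ suc k * 2 ^ (n ∸ k)
length≤-of-nested-heads k n Ts unique length≡n nested =
  length≤-of-injection encode unique encode-injective encode<
  where
  M : ℕ
  M = 2 ^ (n ∸ k)

  encode : List Bool → ℕ
  encode τ = fromBits (drop k τ) + countBelow k (bits τ) * M

  tail< : ∀ {τ} → τ ∈ Ts → fromBits (drop k τ) < M
  tail< {τ} τ∈ = <-≤-trans (fromBits< (drop k τ))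
                           (≤-reflexive (cong (2 ^_) (trans (length-drop k τ) (cong (_∸ k) (length≡n τ∈)))))

  encode< : ∀ {τ} → τ ∈ Ts → encode τ < suc k * M
  encode< {τ} τ∈ = +-mono-<-≤ (tail< τ∈) (*-monoˡ-≤ M (countBelow≤ k (bits τ)))

  encode-injective : ∀ {τ τ′} → τ ∈ Ts → τ′ ∈ Ts → encode τ ≡ encode τ′ → τ ≡ τ′
  encode-injective {τ} {τ′} τ∈ τ′∈ eq
    with tail≡ , count≡ ← +-*-injective M {{m^n≢0 2 (n ∸ k)}} (tail< τ∈) (tail< τ′∈) eq =
    bits-injective τ τ′ (trans (length≡n τ∈) (sym (length≡n τ′∈))) agree
    where
    tails : ∀ i → k ≤ i → bits τ i ≡ bits τ′ i
    tails = fromBits-drop-injective k τ τ′ tail≡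
    heads : ∀ x → x < k → bits τ x ≡ bits τ′ x
    heads = [ (λ τ⊆τ′ → countBelow-nested-≡ k τ⊆τ′ count≡)
            , (λ τ′⊆τ x x<k → sym (countBelow-nested-≡ k τ′⊆τ (sym count≡) x x<k)) ]′ (nested τ∈ τ′∈ tails)
    agree : ∀ i → bits τ i ≡ bits τ′ i
    agree i with k ≤? i
    ... | yes k≤i = tails i k≤i
    ... | no  k≰i = heads i (≰⇒> k≰i)

-- The measure of each level of the test

_⊑_ : List Bool → List Bool → Set
σ ⊑ τ = length σ ≤ length τ × (∀ i → i < length σ → bits σ i ≡ bits τ i)

∷-⊑ : ∀ {b σ τ} → σ ⊑ τ → (b ∷ σ) ⊑ (b ∷ τ)
∷-⊑ (σ≤τ , agree) = s≤s σ≤τ , λ { zero _ → refl ; (suc i) (s≤s i<σ) → agree i i<σ }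

isPrefix⇒⊑ : ∀ σ τ → T (isPrefix σ τ) → σ ⊑ τ
isPrefix⇒⊑ []          τ           _ = z≤n , λ _ ()
isPrefix⇒⊑ (true ∷ σ)  (true ∷ τ)  p = ∷-⊑ (isPrefix⇒⊑ σ τ p)
isPrefix⇒⊑ (false ∷ σ) (false ∷ τ) p = ∷-⊑ (isPrefix⇒⊑ σ τ p)

allStrings-length : ∀ n {τ} → τ ∈ allStrings n → length τ ≡ n
allStrings-length zero    (here refl) = refl
allStrings-length (suc n) τ∈ with ∈-++⁻ (map (true ∷_) (allStrings n)) τ∈
... | inj₁ τ∈₁ with _ , τ′∈ , refl ← ∈-map⁻ (true ∷_) τ∈₁  = cong suc (allStrings-length n τ′∈)
... | inj₂ τ∈₂ with _ , τ′∈ , refl ← ∈-map⁻ (false ∷_) τ∈₂ = cong suc (allStrings-length n τ′∈)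

allStrings-unique : ∀ n → Unique (allStrings n)
allStrings-unique zero    = [] ∷ []
allStrings-unique (suc n) = Unique.++⁺ (Unique.map⁺ ∷-injectiveʳ (allStrings-unique n))
                                       (Unique.map⁺ ∷-injectiveʳ (allStrings-unique n)) disjoint
  where
  disjoint : ∀ {τ} → ¬ (τ ∈ map (true ∷_) (allStrings n) × τ ∈ map (false ∷_) (allStrings n))
  disjoint (τ∈₁ , τ∈₂) with _ , _ , refl ← ∈-map⁻ (true ∷_) τ∈₁ with _ , _ , () ← ∈-map⁻ (false ∷_) τ∈₂

1+n≤2^n : ∀ n → suc n ≤ 2 ^ n
1+n≤2^n zero    = ≤-refl
1+n≤2^n (suc n) =
  ≤-trans (≤-reflexive (+-comm 1 (suc n))) (+-mono-≤ (1+n≤2^n n) (≤-trans (m^n>0 2 n) (m≤m+n (2 ^ n) 0)))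

headLength-bound : ∀ m {n} → headLength m ≤ n →
                   suc (headLength m) * 2 ^ (n ∸ headLength m) * 2 ^ m ≤ 2 ^ n
headLength-bound m {n} k≤n = begin
  suc k * 2 ^ r * 2 ^ m     ≡⟨ swap (suc k) (2 ^ r) (2 ^ m) ⟩
  suc k * 2 ^ m * 2 ^ r     ≡⟨ cong (_* 2 ^ r) (regroup m (2 ^ m)) ⟩
  suc m * (2 * 2 ^ m) * 2 ^ r ≤⟨ *-monoˡ-≤ (2 ^ r) (*-monoˡ-≤ (2 * 2 ^ m) (1+n≤2^n m)) ⟩
  2 ^ m * (2 * 2 ^ m) * 2 ^ r ≡⟨ cong (_* 2 ^ r) (square (2 ^ m)) ⟩
  2 * (2 ^ m * 2 ^ m) * 2 ^ r ≡⟨ cong (λ p → 2 * p * 2 ^ r) (sym (^-distribˡ-+-* 2 m m)) ⟩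
  2 ^ k * 2 ^ r             ≡⟨ sym (^-distribˡ-+-* 2 k r) ⟩
  2 ^ (k + r)               ≡⟨ cong (2 ^_) (m+[n∸m]≡n k≤n) ⟩
  2 ^ n                     ∎
  where
  open ≤-Reasoning
  k r : ℕ
  k = headLength m
  r = n ∸ k
  swap : ∀ a b c → a * b * c ≡ a * c * b
  swap = solve-∀
  regroup : ∀ m p → suc (suc (m + m)) * p ≡ suc m * (2 * p)
  regroup = solve-∀
  square : ∀ p → p * (2 * p) ≡ 2 * (p * p)
  square = solve-∀

module _ (Γ : PR 2) (m : ℕ) (L : List (List Bool)) (L⊆test : All (λ σ → ⟨ m , code σ ⟩ ∈W test Γ) L)
         (n : ℕ) where

  private
    k : ℕ
    k = headLength m

    covered : List Bool → Bool
    covered τ = any (λ σ → isPrefix σ τ) L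

    Ts : List (List Bool)
    Ts = filterᵇ covered (allStrings n)

  covering-prefix : ∀ {τ} → T (covered τ) → ∃[ σ ] ⟨ m , code σ ⟩ ∈W test Γ × T (isPrefix σ τ)
  covering-prefix {τ} τ-covered = Any.lookup some , All.lookupAny L⊆test some
    where
    some : Any.Any (λ σ → T (isPrefix σ τ)) L
    some = any⁻ (λ σ → isPrefix σ τ) L τ-covered

  covered⇒headEnumerated : ∀ {τ} → τ ∈ Ts → ∃[ N ] N ≤ n × HeadEnumerated Γ k N (bits τ)
  covered⇒headEnumerated {τ} τ∈Ts =
    let τ∈all , τ-covered = ∈-filter⁻ (T? ∘ covered) {xs = allStrings n} τ∈Ts
        σ , σ∈test , σ-prefix = covering-prefix τ-covered
        σ≤τ , agree = isPrefix⇒⊑ σ τ σ-prefix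
    in length σ , ≤-trans σ≤τ (≤-reflexive (allStrings-length n τ∈all)) ,
       HeadEnumerated-cong Γ agree (Equivalence.to (∈W-test⇔ Γ m σ) σ∈test)

  covered-length : ∀ {τ} → τ ∈ Ts → length τ ≡ n
  covered-length τ∈Ts = allStrings-length n (proj₁ (∈-filter⁻ (T? ∘ covered) {xs = allStrings n} τ∈Ts))

  covered-nested : ∀ {τ τ′} → τ ∈ Ts → τ′ ∈ Ts → (∀ i → k ≤ i → bits τ i ≡ bits τ′ i) →
                   NestedBelow k (bits τ) (bits τ′) ⊎ NestedBelow k (bits τ′) (bits τ)
  covered-nested τ∈ τ′∈ =
    HeadEnumerated-comparable Γ (proj₂ (proj₂ (covered⇒headEnumerated τ∈)))
                                (proj₂ (proj₂ (covered⇒headEnumerated τ′∈)))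

  countCover≤ : countCover n L * 2 ^ m ≤ 2 ^ n
  countCover≤ with k ≤? n
  ... | yes k≤n =
    ≤-trans (*-monoˡ-≤ (2 ^ m) (length≤-of-nested-heads k n Ts unique covered-length covered-nested))
            (headLength-bound m k≤n)
    where
    unique : Unique Ts
    unique = Unique.filter⁺ (T? ∘ covered) (allStrings-unique n)
  ... | no k≰n = subst (λ l → l * 2 ^ m ≤ 2 ^ n) (sym (length≡0-if-empty Ts uncovered)) z≤n
    where
    uncovered : ∀ {τ} → ¬ τ ∈ Ts
    uncovered τ∈ = let _ , N≤n , k≤N , _ = covered⇒headEnumerated τ∈ in k≰n (≤-trans k≤N N≤n)

test-isMLTest : ∀ Γ → MLTest (test Γ)
test-isMLTest = countCover≤

mainTheorem11 : ∀ (A : Set2ω) → MLRandom A → ¬ UniformlyIntroenumerable A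
mainTheorem11 A random (A-infinite , Γ , Γ-uniform) =
  random (test Γ) (test-isMLTest Γ) (∈test A-infinite Γ-uniform)
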